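{- (i) For every integer $k\ge 2$ and every $n$, $\mathrm{ex}_{\mathrm{ori}}(n,\overrightarrow{P_k})=|E(T(n,k-1))|$. (ii) For every tournament $\overrightarrow{F}$ whose compressibility $z(\overrightarrow{F})$ exists, and every $n$, $\mathrm{ex}_{\mathrm{ori}}(n,\overrightarrow{F})=|E(T(n,z(\overrightarrow{F})-1))|$. (iii) Let $\overrightarrow{F}$ be the oriented $4$-cycle with vertices $v_1,v_2,v_3,v_4$ and arcs $\overrightarrow{v_1v_2}$, $\overrightarrow{v_2v_3}$, $\overrightarrow{v_3v_4}$, $\overrightarrow{v_1v_4}$. Then for every $n$, $\mathrm{ex}_{\mathrm{ori}}(n,\overrightarrow{F})=|E(T(n,3))|$.
   Context: An oriented graph is a directed graph with no loops, no multiple arcs and no pair of opposite arcs. $\mathrm{ex}_{\mathrm{ori}}(n,\overrightarrow{F})$ is the largest number of arcs in an $n$-vertex oriented graph not containing $\overrightarrow{F}$ as a (not necessarily induced) subgraph. $\overrightarrow{P_k}$ is the directed path on $k$ vertices (all arcs oriented in the same direction along the path). A homomorphism from a digraph $H$ to a digraph $D$ is a map $f:V(H)\to V(D)$ with $f(u)f(v)\in E(D)$ whenever $uv\in E(H)$. The compressibility $z(\overrightarrow{F})$ is the smallest $k$ such that there is a homomorphism from $\overrightarrow{F}$ to every tournament on $k$ vertices (it exists exactly when $\overrightarrow{F}$ has no directed cycle). $T(n,k)$ is the Turán graph, the complete $k$-partite graph on $n$ vertices with part sizes as equal as possible. -}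

module Defs where

open import Data.Nat using (ℕ; zero; suc; _≤_; _<ᵇ_; _≡ᵇ_; _%_)
open import Data.Nat.ListAction using (sum)
open import Data.Bool using (Bool; true; false; if_then_else_; _∧_; not)
open import Data.Fin using (Fin; toℕ)
open import Data.List using (List; map; allFin)
open import Data.Product using (Σ; _×_)
open import Data.Sum using (_⊎_)
open import Relation.Binary.PropositionalEquality using (_≡_; _≢_)
open import Relation.Nullary using (¬_)
open import Function.Definitions using (Injective)

-- A digraph on vertex set Fin n, given by its (Boolean) arc relation:
-- D u v ≡ true  means there is an arc u → v.  (Simple: no multiple arcs.)
Digraph : ℕ → Set
Digraph n = Fin n → Fin n → Bool

Oriented : ∀ {n} → Digraph n → Set
Oriented {n} D = ((u : Fin n) → D u u ≡ false)
               × ((u v : Fin n) → D u v ≡ true → D v u ≡ false)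

Tournament : ∀ {n} → Digraph n → Set
Tournament {n} D = Oriented D
                 × ((u v : Fin n) → u ≢ v → (D u v ≡ true) ⊎ (D v u ≡ true))

countTrue : ∀ {n} → (Fin n → Fin n → Bool) → ℕ
countTrue {n} D =
  sum (map (λ u → sum (map (λ v → if D u v then 1 else 0) (allFin n))) (allFin n))

arcs : ∀ {n} → Digraph n → ℕ
arcs D = countTrue D

Hom : ∀ {m n} → Digraph m → Digraph n → Set
Hom {m} {n} H D = Σ (Fin m → Fin n) λ f →
  (u v : Fin m) → H u v ≡ true → D (f u) (f v) ≡ true

-- D contains F as a (not necessarily induced) subgraph: an injective homomorphism
Contains : ∀ {n m} → Digraph n → Digraph m → Set
Contains {n} {m} D F = Σ (Fin m → Fin n) λ f →
  Injective _≡_ _≡_ f × ((u v : Fin m) → F u v ≡ true → D (f u) (f v) ≡ true)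

ExOri : ∀ {m} → ℕ → Digraph m → ℕ → Set
ExOri {m} n F t =
  (Σ (Digraph n) λ D → Oriented D × ¬ Contains D F × arcs D ≡ t)
  × ((D : Digraph n) → Oriented D → ¬ Contains D F → arcs D ≤ t)

HomToAllTournaments : ∀ {m} → Digraph m → ℕ → Set
HomToAllTournaments F k = (T : Digraph k) → Tournament T → Hom F T

IsCompressibility : ∀ {m} → Digraph m → ℕ → Set
IsCompressibility F z =
  HomToAllTournaments F z × ((k : ℕ) → HomToAllTournaments F k → z ≤ k)

-- Turán graph T(n,k) (k ≥ 1) on Fin n: vertex u lies in part (toℕ u mod k);
-- the k residue classes have sizes as equal as possible.  Adjacent iff
-- in different parts.  (k = 0 is degenerate and never used: empty graph.)
turanAdj : (n k : ℕ) → Fin n → Fin n → Bool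
turanAdj n zero    u v = false
turanAdj n (suc j) u v = not ((toℕ u % suc j) ≡ᵇ (toℕ v % suc j))

turanEdges : ℕ → ℕ → ℕ
turanEdges n k = countTrue {n} (λ u v → (toℕ u <ᵇ toℕ v) ∧ turanAdj n k u v)

pathDigraph : (k : ℕ) → Digraph k
pathDigraph k u v = toℕ v ≡ᵇ suc (toℕ u)

-- oriented 4-cycle with arcs v1v2, v2v3, v3v4, v1v4 (v_i = i-1 in Fin 4)
c4 : Digraph 4
c4 u v = arc (toℕ u) (toℕ v)
  where
  arc : ℕ → ℕ → Bool
  arc 0 1 = true
  arc 1 2 = true
  arc 2 3 = true
  arc 0 3 = true
  arc _ _ = false

module Submission where

-- Suppose every tournament on r + 2 vertices contains F, while some tournament T₀ on r + 1 vertices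
-- admits no homomorphism from F. Blowing up T₀ along the residue classes modulo r + 1 gives an F-free
-- oriented graph whose underlying graph is T(n, r + 1). Conversely, in an F-free oriented graph no
-- r + 2 vertices are pairwise adjacent, since they would span a tournament and hence a copy of F, so
-- Turán's theorem bounds the number of arcs. Turán's theorem is proved by induction on n: either some
-- vertex has at most the degree of the last vertex of T(n, r + 1) and is deleted, or every vertex has
-- so few non-neighbours that r + 2 pairwise adjacent vertices can be chosen greedily.
--
-- For P_k the hypotheses are Rédei's theorem (insertion sort along the arcs of a tournament yields a
-- Hamiltonian path) and the transitive tournament on k - 1 vertices. For a tournament F they hold with
-- r + 2 = z(F): a homomorphism between tournaments is injective, and by minimality of z(F) an exhaustive
-- search finds a tournament on z(F) - 1 vertices without a homomorphism from F. For the oriented 4-cycle,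
-- T₀ is transitive on 3 vertices, and a copy in a 4-vertex tournament is obtained by relabelling a
-- Hamiltonian path according to the orientations of the three remaining pairs.

open import Defs
open import Data.Bool using (Bool; true; false; not; _∧_; _∨_; if_then_else_)
open import Data.Bool.Properties using (∨-comm) renaming (_≟_ to _≟ᵇ_)
open import Data.Empty using (⊥; ⊥-elim)
open import Data.Fin using (Fin; toℕ; zero; suc; punchIn; fromℕ; inject₁; finToFun; funToFin) renaming (_≟_ to _≟ᶠ_)
open import Data.Fin.Patterns using (0F; 1F; 2F; 3F)
open import Data.Fin.Induction using (<-weakInduction)
open import Data.Fin.Properties
  using (all?; any?; finToFun-funToFin; 2↔Bool; injective⇒≤; toℕ<n; toℕ-inject₁; toℕ-fromℕ; toℕ-fromℕ<;
         toℕ-injective; fromℕ<-cong)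
open import Data.List using (tabulate) renaming (map to mapL)
open import Data.Nat.ListAction using () renaming (sum to sumL)
open import Data.Nat
  using (ℕ; zero; suc; _+_; _*_; _^_; _∸_; _%_; _/_; _≤_; _<_; z≤n; s≤s; s≤s⁻¹; _≡ᵇ_; _<ᵇ_; _≟_; _≤?_; _<?_)
open import Data.Nat.Properties
open import Data.Nat.DivMod using (_mod_; m≡m%n+[m/n]*n; m%n<n; m<n⇒m%n≡m; [m+n]%n≡m%n; m/n*n≤m)
open import Data.Nat.Divisibility using (_∣_; divides; n∣m*n; ∣m+n∣m⇒∣n; >⇒∤)
open import Data.Product using (Σ; ∃; _×_; _,_; proj₁; proj₂)
open import Data.Sum using (_⊎_; inj₁; inj₂) renaming (map to ⊎-map)
open import Data.Vec using (Vec; []; _∷_; lookup) renaming (map to mapV; allFin to allFinV)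
open import Data.Vec.Relation.Unary.All using (All; []; _∷_)
import Data.Vec.Relation.Unary.All as All
import Data.Vec.Relation.Unary.All.Properties as All
open import Data.Vec.Relation.Unary.Unique.Propositional using (Unique)
open import Data.Vec.Relation.Unary.Unique.Propositional.Properties using (lookup-injective; tabulate⁺)
open import Data.Vec.Relation.Unary.Linked using (Linked; []; [-]; _∷_)
open import Data.Vec.Relation.Unary.AllPairs as AllPairs using (AllPairs; []; _∷_; allPairs?)
import Data.Vec.Relation.Unary.AllPairs.Properties as AllPairsₚ
open import Function using (_∘_; id)
open import Function.Bundles using (Inverse)
open import Function.Definitions using (Injective)
open import Relation.Binary.Definitions using (tri<; tri≈; tri>)
open import Relation.Binary.PropositionalEquality
open import Relation.Nullary using (¬_; ¬?; Dec; yes; no; does)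
open import Relation.Nullary.Decidable using (dec-true; dec-false; True; toWitness; map′; _×-dec_; _⊎-dec_; _→-dec_)

open import Algebra.Properties.CommutativeMonoid.Sum +-0-commutativeMonoid
  using (sum-syntax; sum-cong-≗; sum-remove; ∑-distrib-+; sum-replicate-zero)

dec-true⁻¹ : ∀ {A : Set} (a? : Dec A) → does a? ≡ true → A
dec-true⁻¹ (yes a) _ = a

AllPairs-lookup : ∀ {A : Set} {R : A → A → Set} → (∀ {x y} → R x y → R y x) →
                  ∀ {k} {xs : Vec A k} → AllPairs R xs → ∀ {i j} → i ≢ j → R (lookup xs i) (lookup xs j)
AllPairs-lookup sym (px ∷ pxs) {zero}  {zero}  i≢j = ⊥-elim (i≢j refl)
AllPairs-lookup sym (px ∷ pxs) {zero}  {suc j} _   = All.lookup⁺ px j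
AllPairs-lookup sym (px ∷ pxs) {suc i} {zero}  _   = sym (All.lookup⁺ px i)
AllPairs-lookup sym (px ∷ pxs) {suc i} {suc j} i≢j = AllPairs-lookup sym pxs (i≢j ∘ cong suc)

Linked-lookup : ∀ {A : Set} {R : A → A → Set} {k} {xs : Vec A k} → Linked R xs →
                ∀ {i j} → toℕ j ≡ suc (toℕ i) → R (lookup xs i) (lookup xs j)
Linked-lookup {xs = _ ∷ _ ∷ _} (x~y ∷ _)  {zero}  {suc zero}    _  = x~y
Linked-lookup {xs = _ ∷ _ ∷ _} (_ ∷ ys~) {suc i} {suc j}       eq = Linked-lookup ys~ (suc-injective eq)
Linked-lookup {xs = _ ∷ _ ∷ _} _         {zero}  {suc (suc j)} eq with suc-injective eq
... | ()
Linked-lookup {xs = _ ∷ []} [-] {zero} {suc ()}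

toℕ-punchIn-fromℕ : ∀ {s} (a : Fin s) → toℕ (punchIn (fromℕ s) a) ≡ toℕ a
toℕ-punchIn-fromℕ {suc s} zero    = refl
toℕ-punchIn-fromℕ {suc s} (suc a) = cong suc (toℕ-punchIn-fromℕ a)

-- Finite sums

⟦_⟧ : Bool → ℕ
⟦ b ⟧ = if b then 1 else 0

⟦not⟧+⟦⟧ : ∀ b → ⟦ not b ⟧ + ⟦ b ⟧ ≡ 1
⟦not⟧+⟦⟧ true  = refl
⟦not⟧+⟦⟧ false = refl

∑-tabulate : ∀ {A : Set} {n} (f : A → ℕ) (g : Fin n → A) →
             sumL (mapL f (tabulate g)) ≡ ∑[ i < n ] f (g i)
∑-tabulate {n = zero}  f g = refl
∑-tabulate {n = suc n} f g = cong (f (g zero) +_) (∑-tabulate f (g ∘ suc))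

countTrue≡∑ : ∀ {n} (D : Fin n → Fin n → Bool) →
              countTrue D ≡ ∑[ u < n ] ∑[ v < n ] ⟦ D u v ⟧
countTrue≡∑ {n} D =
  trans (∑-tabulate {n = n} _ id) (sum-cong-≗ λ u → ∑-tabulate {n = n} (λ v → ⟦ D u v ⟧) id)

∑-mono-≤ : ∀ {n} {f g : Fin n → ℕ} → (∀ i → f i ≤ g i) → ∑[ i < n ] f i ≤ ∑[ i < n ] g i
∑-mono-≤ {zero}  f≤g = z≤n
∑-mono-≤ {suc n} f≤g = +-mono-≤ (f≤g zero) (∑-mono-≤ (f≤g ∘ suc))

∑-≤-* : ∀ {n q} {f : Fin n → ℕ} → (∀ i → f i ≤ q) → ∑[ i < n ] f i ≤ n * q
∑-≤-* {zero}  f≤q = z≤n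
∑-≤-* {suc n} f≤q = +-mono-≤ (f≤q zero) (∑-≤-* (f≤q ∘ suc))

∑-1 : ∀ n → ∑[ i < n ] 1 ≡ n
∑-1 zero    = refl
∑-1 (suc n) = cong suc (∑-1 n)

∑⟦not⟧<⇒∃ : ∀ {n} (b : Fin n → Bool) → ∑[ i < n ] ⟦ not (b i) ⟧ < n → ∃ λ i → b i ≡ true
∑⟦not⟧<⇒∃ {suc n} b sum<n with b zero in eq
... | true  = zero , eq
... | false = let i , bi = ∑⟦not⟧<⇒∃ (b ∘ suc) (s≤s⁻¹ sum<n) in suc i , bi

∑ℕ : ℕ → (ℕ → ℕ) → ℕ
∑ℕ s f = ∑[ i < s ] f (toℕ i)

∑ℕ-cong : ∀ s {f g : ℕ → ℕ} → (∀ i → i < s → f i ≡ g i) → ∑ℕ s f ≡ ∑ℕ s g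
∑ℕ-cong s f≡g = sum-cong-≗ (λ i → f≡g (toℕ i) (toℕ<n i))

∑ℕ-0 : ∀ s {f : ℕ → ℕ} → (∀ i → i < s → f i ≡ 0) → ∑ℕ s f ≡ 0
∑ℕ-0 s f≡0 = trans (∑ℕ-cong s f≡0) (sum-replicate-zero s)

∑ℕ-distrib-+ : ∀ s (f g : ℕ → ℕ) → ∑ℕ s (λ i → f i + g i) ≡ ∑ℕ s f + ∑ℕ s g
∑ℕ-distrib-+ s f g = ∑-distrib-+ {n = s} (f ∘ toℕ) (g ∘ toℕ)

∑ℕ-+ : ∀ a b (f : ℕ → ℕ) → ∑ℕ (a + b) f ≡ ∑ℕ a f + ∑ℕ b (λ i → f (a + i))
∑ℕ-+ zero    b f = refl
∑ℕ-+ (suc a) b f = trans (cong (f 0 +_) (∑ℕ-+ a b (f ∘ suc))) (sym (+-assoc (f 0) _ _))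

∑ℕ-suc : ∀ s (f : ℕ → ℕ) → ∑ℕ (suc s) f ≡ ∑ℕ s f + f s
∑ℕ-suc s f = begin
  ∑ℕ (suc s) f                  ≡⟨ cong (λ t → ∑ℕ t f) (+-comm 1 s) ⟩
  ∑ℕ (s + 1) f                  ≡⟨ ∑ℕ-+ s 1 f ⟩
  ∑ℕ s f + (f (s + 0) + 0)      ≡⟨ cong (∑ℕ s f +_) (trans (+-identityʳ _) (cong f (+-identityʳ s))) ⟩
  ∑ℕ s f + f s                  ∎
  where open ≡-Reasoning

-- The Turán numbers

module TuránNumber (r : ℕ) where

  differentClass : ℕ → ℕ → Bool
  differentClass a b = not (a % suc r ≡ᵇ b % suc r)

  otherClass sameClass : ℕ → ℕ
  otherClass s = ∑ℕ s (λ a → ⟦ differentClass a s ⟧)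
  sameClass  s = ∑ℕ s (λ a → ⟦ a % suc r ≡ᵇ s % suc r ⟧)

  turanEdges≡∑ℕ : ∀ s →
                  turanEdges s (suc r) ≡ ∑ℕ s (λ a → ∑ℕ s (λ b → ⟦ (a <ᵇ b) ∧ differentClass a b ⟧))
  turanEdges≡∑ℕ s = countTrue≡∑ (λ (u v : Fin s) → (toℕ u <ᵇ toℕ v) ∧ differentClass (toℕ u) (toℕ v))

  turanEdges-suc : ∀ s → turanEdges (suc s) (suc r) ≡ turanEdges s (suc r) + otherClass s
  turanEdges-suc s = begin
    turanEdges (suc s) (suc r)
      ≡⟨ turanEdges≡∑ℕ (suc s) ⟩
    ∑ℕ (suc s) (λ a → ∑ℕ (suc s) (E a))
      ≡⟨ ∑ℕ-cong (suc s) (λ a _ → ∑ℕ-suc s (E a)) ⟩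
    ∑ℕ (suc s) (λ a → ∑ℕ s (E a) + E a s)
      ≡⟨ ∑ℕ-distrib-+ (suc s) (λ a → ∑ℕ s (E a)) (λ a → E a s) ⟩
    ∑ℕ (suc s) (λ a → ∑ℕ s (E a)) + ∑ℕ (suc s) (λ a → E a s)
      ≡⟨ cong₂ _+_ (∑ℕ-suc s (λ a → ∑ℕ s (E a))) (∑ℕ-suc s (λ a → E a s)) ⟩
    (∑ℕ s (λ a → ∑ℕ s (E a)) + ∑ℕ s (E s)) + (∑ℕ s (λ a → E a s) + E s s)
      ≡⟨ cong₂ (λ x y → (∑ℕ s (λ a → ∑ℕ s (E a)) + x) + (∑ℕ s (λ a → E a s) + y))
               (∑ℕ-0 s (λ b b<s → E-≮ (<⇒≯ b<s))) (E-≮ (n≮n s)) ⟩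
    (∑ℕ s (λ a → ∑ℕ s (E a)) + 0) + (∑ℕ s (λ a → E a s) + 0)
      ≡⟨ cong₂ _+_ (trans (+-identityʳ _) (sym (turanEdges≡∑ℕ s)))
                   (trans (+-identityʳ _) (∑ℕ-cong s λ a a<s →
                     cong (λ x → ⟦ x ∧ differentClass a s ⟧) (dec-true (a <? s) a<s))) ⟩
    turanEdges s (suc r) + otherClass s ∎
    where
    open ≡-Reasoning
    E : ℕ → ℕ → ℕ
    E a b = ⟦ (a <ᵇ b) ∧ differentClass a b ⟧
    E-≮ : ∀ {a b} → ¬ a < b → E a b ≡ 0
    E-≮ {a} {b} a≮b = cong (λ x → ⟦ x ∧ differentClass a b ⟧) (dec-false (a <? b) a≮b)

  otherClass+sameClass : ∀ s → otherClass s + sameClass s ≡ s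
  otherClass+sameClass s = begin
    otherClass s + sameClass s
      ≡⟨ ∑ℕ-distrib-+ s (λ a → ⟦ differentClass a s ⟧) (λ a → ⟦ a % suc r ≡ᵇ s % suc r ⟧) ⟨
    ∑ℕ s (λ a → ⟦ differentClass a s ⟧ + ⟦ a % suc r ≡ᵇ s % suc r ⟧)
      ≡⟨ ∑ℕ-cong s (λ a _ → ⟦not⟧+⟦⟧ (a % suc r ≡ᵇ s % suc r)) ⟩
    ∑ℕ s (λ _ → 1)
      ≡⟨ ∑-1 s ⟩
    s ∎
    where open ≡-Reasoning

  shift-%-≢ : ∀ t {i} → i < r → (t + suc i) % suc r ≢ t % suc r
  shift-%-≢ t {i} i<r eq = >⇒∤ (s≤s i<r) (∣m+n∣m⇒∣n R∣t/R*R+k (n∣m*n (t / suc r)))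
    where
    k : ℕ
    k = suc i
    t/R*R+k≡[t+k]/R*R : t / suc r * suc r + k ≡ (t + k) / suc r * suc r
    t/R*R+k≡[t+k]/R*R = +-cancelˡ-≡ (t % suc r) _ _ (begin
      t % suc r + (t / suc r * suc r + k)       ≡⟨ +-assoc (t % suc r) _ k ⟨
      t % suc r + t / suc r * suc r + k         ≡⟨ cong (_+ k) (m≡m%n+[m/n]*n t (suc r)) ⟨
      t + k                                     ≡⟨ m≡m%n+[m/n]*n (t + k) (suc r) ⟩
      (t + k) % suc r + (t + k) / suc r * suc r ≡⟨ cong (_+ (t + k) / suc r * suc r) eq ⟩
      t % suc r + (t + k) / suc r * suc r       ∎)
      where open ≡-Reasoning
    R∣t/R*R+k : suc r ∣ t / suc r * suc r + k
    R∣t/R*R+k = divides ((t + k) / suc r) t/R*R+k≡[t+k]/R*R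

  sameClass-< : ∀ {s} → s < suc r → sameClass s ≡ 0
  sameClass-< {s} s<R = ∑ℕ-0 s λ a a<s →
    cong ⟦_⟧ (dec-false (a % suc r ≟ s % suc r) λ eq → <⇒≢ a<s (begin
      a           ≡⟨ m<n⇒m%n≡m (<-trans a<s s<R) ⟨
      a % suc r   ≡⟨ eq ⟩
      s % suc r   ≡⟨ m<n⇒m%n≡m s<R ⟩
      s           ∎))
    where open ≡-Reasoning

  sameClass-+R : ∀ t → sameClass (t + suc r) ≡ suc (sameClass t)
  sameClass-+R t = begin
    sameClass (t + suc r)
      ≡⟨ ∑ℕ-cong (t + suc r) (λ a _ → cong (λ x → ⟦ a % suc r ≡ᵇ x ⟧) ([m+n]%n≡m%n t (suc r))) ⟩
    ∑ℕ (t + suc r) (λ a → ⟦ a % suc r ≡ᵇ t % suc r ⟧)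
      ≡⟨ ∑ℕ-+ t (suc r) (λ a → ⟦ a % suc r ≡ᵇ t % suc r ⟧) ⟩
    sameClass t + (⟦ (t + 0) % suc r ≡ᵇ t % suc r ⟧ + ∑ℕ r (λ i → ⟦ (t + suc i) % suc r ≡ᵇ t % suc r ⟧))
      ≡⟨ cong₂ (λ x y → sameClass t + (⟦ x ⟧ + y))
               (dec-true (_ ≟ _) (cong (_% suc r) (+-identityʳ t)))
               (∑ℕ-0 r (λ i i<r → cong ⟦_⟧ (dec-false (_ ≟ _) (shift-%-≢ t i<r)))) ⟩
    sameClass t + 1
      ≡⟨ +-comm (sameClass t) 1 ⟩
    suc (sameClass t) ∎
    where open ≡-Reasoning

  sameClass-+* : ∀ a q → a < suc r → sameClass (a + q * suc r) ≡ q
  sameClass-+* a zero    a<R = trans (cong sameClass (+-identityʳ a)) (sameClass-< a<R)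
  sameClass-+* a (suc q) a<R = begin
    sameClass (a + (suc r + q * suc r)) ≡⟨ cong sameClass (+-comm-middle a (suc r) (q * suc r)) ⟩
    sameClass (a + q * suc r + suc r)   ≡⟨ sameClass-+R (a + q * suc r) ⟩
    suc (sameClass (a + q * suc r))     ≡⟨ cong suc (sameClass-+* a q a<R) ⟩
    suc q                               ∎
    where
    open ≡-Reasoning
    +-comm-middle : ∀ x y z → x + (y + z) ≡ x + z + y
    +-comm-middle x y z = trans (cong (x +_) (+-comm y z)) (sym (+-assoc x z y))

  sameClass≡/ : ∀ s → sameClass s ≡ s / suc r
  sameClass≡/ s = trans (cong sameClass (m≡m%n+[m/n]*n s (suc r))) (sameClass-+* _ (s / suc r) (m%n<n s (suc r)))

  *-sameClass-≤ : ∀ s → suc r * sameClass s ≤ s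
  *-sameClass-≤ s = begin
    suc r * sameClass s   ≡⟨ cong (suc r *_) (sameClass≡/ s) ⟩
    suc r * (s / suc r)   ≡⟨ *-comm (suc r) (s / suc r) ⟩
    s / suc r * suc r     ≤⟨ m/n*n≤m s (suc r) ⟩
    s                     ∎
    where open ≤-Reasoning

-- Oriented graphs and tournaments

adj : ∀ {n} → Digraph n → Fin n → Fin n → Bool
adj D u v = D u v ∨ D v u

Adj : ∀ {n} → Digraph n → Fin n → Fin n → Set
Adj D u v = adj D u v ≡ true

adj-sym : ∀ {n} (D : Digraph n) u v → adj D u v ≡ adj D v u
adj-sym D u v = ∨-comm (D u v) (D v u)

adj-irrefl : ∀ {n} {D : Digraph n} → Oriented D → ∀ v → adj D v v ≡ false
adj-irrefl {D = D} (irr , _) v rewrite irr v = refl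

adj⇒≢ : ∀ {n} {D : Digraph n} → Oriented D → ∀ {u v} → Adj D u v → u ≢ v
adj⇒≢ ori {u} uv refl with trans (sym uv) (adj-irrefl ori u)
... | ()

adj⇒arc : ∀ {n} (D : Digraph n) {u v} → Adj D u v → D u v ≡ true ⊎ D v u ≡ true
adj⇒arc D {u} {v} uv with D u v
... | true  = inj₁ refl
... | false = inj₂ uv

⟦arc⟧+⟦arc⟧≡⟦adj⟧ : ∀ {n} {D : Digraph n} → Oriented D →
                    ∀ u v → ⟦ D u v ⟧ + ⟦ D v u ⟧ ≡ ⟦ adj D u v ⟧
⟦arc⟧+⟦arc⟧≡⟦adj⟧ {D = D} (_ , asym) u v with D u v in uv
... | true  rewrite asym u v uv = refl
... | false = refl

adj-tournament : ∀ {n} {T : Digraph n} → Tournament T → ∀ {u v} → u ≢ v → Adj T u v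
adj-tournament {T = T} (_ , total) {u} {v} u≢v with total u v u≢v
... | inj₁ uv rewrite uv = refl
... | inj₂ vu rewrite vu = ∨-comm (T u v) true

reverse-arc : ∀ {k} {T : Digraph k} → Tournament T → ∀ {x y} → x ≢ y → T x y ≡ false → T y x ≡ true
reverse-arc (_ , total) {x} {y} x≢y xy with total x y x≢y
... | inj₁ xy′ with trans (sym xy′) xy
...   | ()
reverse-arc (_ , total) x≢y xy | inj₂ yx = yx

Hom-∘ : ∀ {k m n} {F : Digraph k} {G : Digraph m} {H : Digraph n} → Hom F G → Hom G H → Hom F H
Hom-∘ (f , f-hom) (g , g-hom) = g ∘ f , λ u v → g-hom (f u) (f v) ∘ f-hom u v

Hom-≗ : ∀ {m n} {F : Digraph m} {T T′ : Digraph n} → (∀ a b → T a b ≡ T′ a b) → Hom F T → Hom F T′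
Hom-≗ T≗T′ h = Hom-∘ h (id , λ a b ab → trans (sym (T≗T′ a b)) ab)

Contains⇒Hom : ∀ {m n} {D : Digraph n} {F : Digraph m} → Contains D F → Hom F D
Contains⇒Hom (f , _ , f-hom) = f , f-hom

Contains-trans : ∀ {k m n} {D : Digraph n} {G : Digraph m} {F : Digraph k} →
                 Contains D G → Contains G F → Contains D F
Contains-trans (g , g-inj , g-hom) (f , f-inj , f-hom) =
  g ∘ f , f-inj ∘ g-inj , λ u v → g-hom (f u) (f v) ∘ f-hom u v

Tournament-≗ : ∀ {n} {T T′ : Digraph n} → (∀ a b → T a b ≡ T′ a b) → Tournament T → Tournament T′
Tournament-≗ T≗T′ ((irr , asym) , total) =
  ( (λ a → trans (sym (T≗T′ a a)) (irr a))
  , λ a b ab → trans (sym (T≗T′ b a)) (asym a b (trans (T≗T′ a b) ab)))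
  , λ a b a≢b → ⊎-map (trans (sym (T≗T′ a b))) (trans (sym (T≗T′ b a))) (total a b a≢b)

tournament-Hom⇒Contains : ∀ {m n} {F : Digraph m} {D : Digraph n} → Tournament F → Oriented D →
                          Hom F D → Contains D F
tournament-Hom⇒Contains {F = F} {D} (_ , total) (irr , _) (f , f-hom) = f , f-inj , f-hom
  where
  loop : ∀ {u v} → f u ≡ f v → F u v ≡ true → ⊥
  loop {u} {v} fu≡fv uv
    with trans (sym (f-hom u v uv)) (subst (λ x → D x (f v) ≡ false) (sym fu≡fv) (irr (f v)))
  ... | ()
  f-inj : Injective _≡_ _≡_ f
  f-inj {u} {v} fu≡fv with u ≟ᶠ v
  ... | yes u≡v = u≡v
  ... | no  u≢v with total u v u≢v
  ...   | inj₁ uv = ⊥-elim (loop fu≡fv uv)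
  ...   | inj₂ vu = ⊥-elim (loop (sym fu≡fv) vu)

arcs-cong : ∀ {n} {D D′ : Digraph n} → (∀ u v → D u v ≡ D′ u v) → arcs D ≡ arcs D′
arcs-cong {D = D} {D′} D≗D′ = begin
  arcs D                          ≡⟨ countTrue≡∑ D ⟩
  ∑[ u < _ ] ∑[ v < _ ] ⟦ D u v ⟧  ≡⟨ sum-cong-≗ (λ u → sum-cong-≗ (λ v → cong ⟦_⟧ (D≗D′ u v))) ⟩
  ∑[ u < _ ] ∑[ v < _ ] ⟦ D′ u v ⟧ ≡⟨ countTrue≡∑ D′ ⟨
  arcs D′                         ∎
  where open ≡-Reasoning

deg : ∀ {n} → Digraph n → Fin n → ℕ
deg {n} D v = ∑[ w < n ] ⟦ adj D v w ⟧

nonNbrs : ∀ {n} → Digraph n → Fin n → ℕ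
nonNbrs {n} D v = ∑[ w < n ] ⟦ not (adj D v w) ⟧

nonNbrs+deg : ∀ {n} (D : Digraph n) v → nonNbrs D v + deg D v ≡ n
nonNbrs+deg {n} D v = begin
  nonNbrs D v + deg D v
    ≡⟨ ∑-distrib-+ (λ w → ⟦ not (adj D v w) ⟧) (λ w → ⟦ adj D v w ⟧) ⟨
  ∑[ w < n ] (⟦ not (adj D v w) ⟧ + ⟦ adj D v w ⟧)
    ≡⟨ sum-cong-≗ (λ w → ⟦not⟧+⟦⟧ (adj D v w)) ⟩
  ∑[ w < n ] 1
    ≡⟨ ∑-1 n ⟩
  n ∎
  where open ≡-Reasoning

deleteVertex : ∀ {n} → Digraph (suc n) → Fin (suc n) → Digraph n
deleteVertex D v a b = D (punchIn v a) (punchIn v b)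

deleteVertex-oriented : ∀ {n} {D : Digraph (suc n)} → Oriented D → ∀ v → Oriented (deleteVertex D v)
deleteVertex-oriented (irr , asym) v = irr ∘ punchIn v , λ a b → asym (punchIn v a) (punchIn v b)

arcs-deleteVertex : ∀ {n} {D : Digraph (suc n)} → Oriented D → ∀ v →
                    arcs D ≡ deg D v + arcs (deleteVertex D v)
arcs-deleteVertex {n} {D} ori v = begin
  arcs D
    ≡⟨ countTrue≡∑ D ⟩
  ∑[ u < suc n ] ∑[ w < suc n ] ⟦ D u w ⟧
    ≡⟨ sum-remove {i = v} (λ u → ∑[ w < suc n ] ⟦ D u w ⟧) ⟩
  ∑[ w < suc n ] ⟦ D v w ⟧ + ∑[ a < n ] ∑[ w < suc n ] ⟦ D (punchIn v a) w ⟧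
    ≡⟨ cong₂ _+_ (sum-remove {i = v} (λ w → ⟦ D v w ⟧))
                 (sum-cong-≗ λ a → sum-remove {i = v} (λ w → ⟦ D (punchIn v a) w ⟧)) ⟩
  (⟦ D v v ⟧ + out) + ∑[ a < n ] (⟦ D (punchIn v a) v ⟧ + ∑[ b < n ] ⟦ D′ a b ⟧)
    ≡⟨ cong₂ _+_ (cong (λ x → ⟦ x ⟧ + out) (proj₁ ori v))
                 (∑-distrib-+ (λ a → ⟦ D (punchIn v a) v ⟧) (λ a → ∑[ b < n ] ⟦ D′ a b ⟧)) ⟩
  out + (in′ + ∑[ a < n ] ∑[ b < n ] ⟦ D′ a b ⟧)
    ≡⟨ +-assoc out in′ _ ⟨
  out + in′ + ∑[ a < n ] ∑[ b < n ] ⟦ D′ a b ⟧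
    ≡⟨ cong₂ _+_ (∑-distrib-+ (λ b → ⟦ D v (punchIn v b) ⟧) (λ b → ⟦ D (punchIn v b) v ⟧))
                 (countTrue≡∑ D′) ⟨
  ∑[ b < n ] (⟦ D v (punchIn v b) ⟧ + ⟦ D (punchIn v b) v ⟧) + arcs D′
    ≡⟨ cong (_+ arcs D′) (sum-cong-≗ λ b → ⟦arc⟧+⟦arc⟧≡⟦adj⟧ ori v (punchIn v b)) ⟩
  ∑[ b < n ] ⟦ adj D v (punchIn v b) ⟧ + arcs D′
    ≡⟨ cong (_+ arcs D′) (trans (sum-remove {i = v} (λ w → ⟦ adj D v w ⟧))
                                (cong (λ x → ⟦ x ⟧ + ∑[ b < n ] ⟦ adj D v (punchIn v b) ⟧) (adj-irrefl ori v))) ⟨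
  deg D v + arcs D′ ∎
  where
  open ≡-Reasoning
  D′ : Digraph n
  D′ = deleteVertex D v
  out in′ : ℕ
  out = ∑[ b < n ] ⟦ D v (punchIn v b) ⟧
  in′ = ∑[ a < n ] ⟦ D (punchIn v a) v ⟧

-- Turán's theorem

IsClique : ∀ {n k} → Digraph n → Vec (Fin n) k → Set
IsClique D C = AllPairs (Adj D) C

deleteVertex-IsClique : ∀ {n k} {D : Digraph (suc n)} v {C : Vec (Fin n) k} →
                        IsClique (deleteVertex D v) C → IsClique D (mapV (punchIn v) C)
deleteVertex-IsClique v = AllPairsₚ.map⁺

induced : ∀ {n k} → Digraph n → Vec (Fin n) k → Digraph k
induced D C i j = D (lookup C i) (lookup C j)

module _ {n k} {D : Digraph n} (ori : Oriented D) {C : Vec (Fin n) k} (clique : IsClique D C) where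

  induced-tournament : Tournament (induced D C)
  induced-tournament = (proj₁ ori ∘ lookup C , λ i j → proj₂ ori (lookup C i) (lookup C j))
                     , λ i j → adj⇒arc D ∘ AllPairs-lookup (λ {x} {y} xy → trans (adj-sym D y x) xy) clique

  clique-embedding : Contains D (induced D C)
  clique-embedding = lookup C , lookup-injective (AllPairs.map (adj⇒≢ ori) clique) _ _ , λ _ _ ij → ij

module GreedyClique {n} (D : Digraph n) where

  commonNbr : ∀ {k} → Vec (Fin n) k → Fin n → Bool
  commonNbr []      w = true
  commonNbr (c ∷ C) w = adj D c w ∧ commonNbr C w

  commonNbr⇒All : ∀ {k} (C : Vec (Fin n) k) {w} → commonNbr C w ≡ true → All (λ c → Adj D c w) C
  commonNbr⇒All []      _  = []
  commonNbr⇒All (c ∷ C) {w} eq with adj D c w in cw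
  ... | true = cw ∷ commonNbr⇒All C eq

  ∑⟦not-commonNbr⟧≤ : ∀ {k} (C : Vec (Fin n) k) →
                      ∑[ w < n ] ⟦ not (commonNbr C w) ⟧ ≤ ∑[ i < k ] nonNbrs D (lookup C i)
  ∑⟦not-commonNbr⟧≤ []      = ≤-reflexive (sum-replicate-zero n)
  ∑⟦not-commonNbr⟧≤ (c ∷ C) = begin
    ∑[ w < n ] ⟦ not (adj D c w ∧ commonNbr C w) ⟧
      ≤⟨ ∑-mono-≤ (λ w → ⟦not-∧⟧≤ (adj D c w) (commonNbr C w)) ⟩
    ∑[ w < n ] (⟦ not (adj D c w) ⟧ + ⟦ not (commonNbr C w) ⟧)
      ≡⟨ ∑-distrib-+ (λ w → ⟦ not (adj D c w) ⟧) (λ w → ⟦ not (commonNbr C w) ⟧) ⟩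
    nonNbrs D c + ∑[ w < n ] ⟦ not (commonNbr C w) ⟧
      ≤⟨ +-monoʳ-≤ (nonNbrs D c) (∑⟦not-commonNbr⟧≤ C) ⟩
    nonNbrs D c + ∑[ i < _ ] nonNbrs D (lookup C i) ∎
    where
    open ≤-Reasoning
    ⟦not-∧⟧≤ : ∀ a b → ⟦ not (a ∧ b) ⟧ ≤ ⟦ not a ⟧ + ⟦ not b ⟧
    ⟦not-∧⟧≤ true  b = ≤-refl
    ⟦not-∧⟧≤ false b = s≤s z≤n

  module _ {q} (sparse : ∀ v → nonNbrs D v ≤ q) where

    extendClique : ∀ {k} (C : Vec (Fin n) k) → IsClique D C → k * q < n →
                   Σ (Fin n) λ w → IsClique D (w ∷ C)
    extendClique {k} C clique k*q<n =
      let w , w-common = ∑⟦not⟧<⇒∃ (commonNbr C) few-bad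
      in w , All.map (λ {c} cw → trans (adj-sym D w c) cw) (commonNbr⇒All C w-common) ∷ clique
      where
      few-bad : ∑[ w < n ] ⟦ not (commonNbr C w) ⟧ < n
      few-bad = ≤-<-trans (≤-trans (∑⟦not-commonNbr⟧≤ C) (∑-≤-* (sparse ∘ lookup C))) k*q<n

    greedyClique : ∀ k → k * q < n → Σ (Vec (Fin n) (suc k)) (IsClique D)
    greedyClique zero    0<n   = let w , clique = extendClique [] [] 0<n in w ∷ [] , clique
    greedyClique (suc k) sk*q<n =
      let C , C-clique = greedyClique k (≤-<-trans (m≤n+m (k * q) q) sk*q<n)
          w , clique   = extendClique C C-clique sk*q<n
      in w ∷ C , clique

module _ (r : ℕ) where
  open TuránNumber r

  turán : ∀ {n} (D : Digraph n) → Oriented D →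
          (∀ (C : Vec (Fin n) (suc (suc r))) → ¬ IsClique D C) →
          arcs D ≤ turanEdges n (suc r)
  turán {zero}  D ori noClique = z≤n
  turán {suc s} D ori noClique with any? (λ v → deg D v ≤? otherClass s)
  ... | yes (v , deg≤) = begin
    arcs D                               ≡⟨ arcs-deleteVertex ori v ⟩
    deg D v + arcs (deleteVertex D v)    ≤⟨ +-mono-≤ deg≤ (turán _ (deleteVertex-oriented ori v) noClique′) ⟩
    otherClass s + turanEdges s (suc r)  ≡⟨ +-comm (otherClass s) _ ⟩
    turanEdges s (suc r) + otherClass s  ≡⟨ turanEdges-suc s ⟨
    turanEdges (suc s) (suc r)           ∎
    where
    open ≤-Reasoning
    noClique′ : ∀ C → ¬ IsClique (deleteVertex D v) C
    noClique′ C clique = noClique (mapV (punchIn v) C) (deleteVertex-IsClique {D = D} v clique)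
  ... | no ¬deg≤ =
    let C , clique = GreedyClique.greedyClique D sparse (suc r) (s≤s (*-sameClass-≤ s))
    in ⊥-elim (noClique C clique)
    where
    sparse : ∀ v → nonNbrs D v ≤ sameClass s
    sparse v = +-cancelʳ-≤ (deg D v) _ _ (begin
      nonNbrs D v + deg D v                 ≡⟨ nonNbrs+deg D v ⟩
      suc s                                 ≡⟨ cong suc (otherClass+sameClass s) ⟨
      suc (otherClass s + sameClass s)      ≡⟨ +-comm (suc (otherClass s)) (sameClass s) ⟩
      sameClass s + suc (otherClass s)      ≤⟨ +-monoʳ-≤ (sameClass s) (≰⇒> (¬deg≤ ∘ (v ,_))) ⟩
      sameClass s + deg D v                 ∎)
      where open ≤-Reasoning

-- Blow-ups

module Blowup (r : ℕ) {T₀ : Digraph (suc r)} (tour : Tournament T₀) where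
  open TuránNumber r

  blowup : ∀ n → Digraph n
  blowup n u v = T₀ (toℕ u mod suc r) (toℕ v mod suc r)

  blowup-oriented : ∀ {n} → Oriented (blowup n)
  blowup-oriented = (λ u → proj₁ (proj₁ tour) _) , λ u v → proj₂ (proj₁ tour) _ _

  blowup-Hom : ∀ {n} → Hom (blowup n) T₀
  blowup-Hom = (λ u → toℕ u mod suc r) , λ _ _ uv → uv

  adj-blowup : ∀ {n} (u v : Fin n) → adj (blowup n) u v ≡ differentClass (toℕ u) (toℕ v)
  adj-blowup u v with toℕ u % suc r ≟ toℕ v % suc r
  ... | yes eq rewrite fromℕ<-cong _ _ eq (m%n<n (toℕ u) (suc r)) (m%n<n (toℕ v) (suc r)) =
    trans (adj-irrefl (proj₁ tour) (toℕ v mod suc r)) (cong not (sym (dec-true (_ ≟ _) eq)))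
  ... | no  ne = trans (adj-tournament tour λ eq → ne (begin
    toℕ u % suc r              ≡⟨ toℕ-fromℕ< (m%n<n (toℕ u) (suc r)) ⟨
    toℕ (toℕ u mod suc r)      ≡⟨ cong toℕ eq ⟩
    toℕ (toℕ v mod suc r)      ≡⟨ toℕ-fromℕ< (m%n<n (toℕ v) (suc r)) ⟩
    toℕ v % suc r              ∎)) (cong not (sym (dec-false (_ ≟ _) ne)))
    where open ≡-Reasoning

  deg-blowup-last : ∀ s → deg (blowup (suc s)) (fromℕ s) ≡ otherClass s
  deg-blowup-last s = begin
    deg (blowup (suc s)) (fromℕ s)
      ≡⟨ sum-cong-≗ (λ w → cong ⟦_⟧ (trans (adj-sym (blowup (suc s)) (fromℕ s) w) (adj-blowup w (fromℕ s)))) ⟩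
    ∑ℕ (suc s) (λ a → ⟦ differentClass a (toℕ (fromℕ s)) ⟧)
      ≡⟨ ∑ℕ-cong (suc s) (λ a _ → cong (λ x → ⟦ differentClass a x ⟧) (toℕ-fromℕ s)) ⟩
    ∑ℕ (suc s) (λ a → ⟦ differentClass a s ⟧)
      ≡⟨ ∑ℕ-suc s (λ a → ⟦ differentClass a s ⟧) ⟩
    otherClass s + ⟦ differentClass s s ⟧
      ≡⟨ cong (λ x → otherClass s + ⟦ not x ⟧) (dec-true (s % suc r ≟ s % suc r) refl) ⟩
    otherClass s + 0
      ≡⟨ +-identityʳ _ ⟩
    otherClass s ∎
    where open ≡-Reasoning

  arcs-blowup : ∀ n → arcs (blowup n) ≡ turanEdges n (suc r)
  arcs-blowup zero    = refl
  arcs-blowup (suc s) = begin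
    arcs (blowup (suc s))
      ≡⟨ arcs-deleteVertex blowup-oriented (fromℕ s) ⟩
    deg (blowup (suc s)) (fromℕ s) + arcs (deleteVertex (blowup (suc s)) (fromℕ s))
      ≡⟨ cong₂ _+_ (deg-blowup-last s) (arcs-cong {n = s} λ a b → cong₂ (λ x y → T₀ (x mod suc r) (y mod suc r))
                                                        (toℕ-punchIn-fromℕ a) (toℕ-punchIn-fromℕ b)) ⟩
    otherClass s + arcs (blowup s)
      ≡⟨ +-comm (otherClass s) _ ⟩
    arcs (blowup s) + otherClass s
      ≡⟨ cong (_+ otherClass s) (arcs-blowup s) ⟩
    turanEdges s (suc r) + otherClass s
      ≡⟨ turanEdges-suc s ⟨
    turanEdges (suc s) (suc r) ∎
    where open ≡-Reasoning

exOri≡turanEdges : ∀ {m} (F : Digraph m) r →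
                   ((T : Digraph (suc (suc r))) → Tournament T → Contains T F) →
                   {T₀ : Digraph (suc r)} → Tournament T₀ → ¬ Hom F T₀ →
                   ∀ n → ExOri n F (turanEdges n (suc r))
exOri≡turanEdges F r F⊆tournaments {T₀} tour F↛T₀ n =
  (blowup n , blowup-oriented , F⊈blowup , arcs-blowup n) , F-free⇒≤
  where
  open Blowup r tour
  F⊈blowup : ¬ Contains (blowup n) F
  F⊈blowup F⊆blowup =
    F↛T₀ (Hom-∘ {G = blowup n} {H = T₀} (Contains⇒Hom {D = blowup n} F⊆blowup) blowup-Hom)
  F-free⇒≤ : ∀ D → Oriented D → ¬ Contains D F → arcs D ≤ turanEdges n (suc r)
  F-free⇒≤ D ori F⊈D = turán r D ori λ C clique →
    F⊈D (Contains-trans {D = D} (clique-embedding ori clique) (F⊆tournaments _ (induced-tournament ori clique)))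

-- Paths and the oriented 4-cycle

transitive : ∀ k → Digraph k
transitive k a b = toℕ a <ᵇ toℕ b

transitive-tournament : ∀ {k} → Tournament (transitive k)
transitive-tournament =
  ( (λ a → dec-false (_ <? _) (n≮n (toℕ a)))
  , λ a b ab → dec-false (toℕ b <? toℕ a) (<⇒≯ (dec-true⁻¹ (toℕ a <? toℕ b) ab)))
  , total
  where
  total : ∀ a b → a ≢ b → transitive _ a b ≡ true ⊎ transitive _ b a ≡ true
  total a b a≢b with <-cmp (toℕ a) (toℕ b)
  ... | tri< a<b _ _ = inj₁ (dec-true (_ <? _) a<b)
  ... | tri≈ _ a≡b _ = ⊥-elim (a≢b (toℕ-injective a≡b))
  ... | tri> _ _ b<a = inj₂ (dec-true (_ <? _) b<a)

¬Hom-transitive : ∀ {r} (F : Digraph (suc r)) → (∀ i → F (inject₁ i) (suc i) ≡ true) →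
                  ¬ Hom F (transitive r)
¬Hom-transitive {r} F path (f , f-hom) = n≮n r (begin-strict
  r                    ≡⟨ toℕ-fromℕ r ⟨
  toℕ (fromℕ r)        ≤⟨ climbs (fromℕ r) ⟩
  toℕ (f (fromℕ r))    <⟨ toℕ<n (f (fromℕ r)) ⟩
  r                    ∎)
  where
  open ≤-Reasoning
  climbs : ∀ i → toℕ i ≤ toℕ (f i)
  climbs = <-weakInduction _ z≤n λ i i≤fi → begin
    suc (toℕ i)                ≡⟨ cong suc (toℕ-inject₁ i) ⟨
    suc (toℕ (inject₁ i))      ≤⟨ s≤s i≤fi ⟩
    suc (toℕ (f (inject₁ i)))  ≤⟨ dec-true⁻¹ (_ <? _) (f-hom _ _ (path i)) ⟩
    toℕ (f (suc i))            ∎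

pathDigraph-arc : ∀ {r} (i : Fin r) → pathDigraph (suc r) (inject₁ i) (suc i) ≡ true
pathDigraph-arc i = dec-true (_ ≟ _) (cong suc (sym (toℕ-inject₁ i)))

module Rédei {k} {T : Digraph k} (tour : Tournament T) where

  Arc : Fin k → Fin k → Set
  Arc x y = T x y ≡ true

  insert : ∀ {n} → Fin k → Vec (Fin k) n → Vec (Fin k) (suc n)
  insert x []       = x ∷ []
  insert x (y ∷ ys) with T x y
  ... | true  = x ∷ y ∷ ys
  ... | false = y ∷ insert x ys

  sort : ∀ {n} → Vec (Fin k) n → Vec (Fin k) n
  sort []       = []
  sort (x ∷ xs) = insert x (sort xs)

  All-insert : ∀ {P : Fin k → Set} {n x} {ys : Vec (Fin k) n} → P x → All P ys → All P (insert x ys)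
  All-insert {ys = []}     px []         = px ∷ []
  All-insert {x = x} {ys = y ∷ ys} px (py ∷ pys) with T x y
  ... | true  = px ∷ py ∷ pys
  ... | false = py ∷ All-insert px pys

  All-sort : ∀ {P : Fin k → Set} {n} {xs : Vec (Fin k) n} → All P xs → All P (sort xs)
  All-sort []         = []
  All-sort (px ∷ pxs) = All-insert px (All-sort pxs)

  Unique-insert : ∀ {n x} {ys : Vec (Fin k) n} → All (x ≢_) ys → Unique ys → Unique (insert x ys)
  Unique-insert {ys = []}     _              []             = [] ∷ []
  Unique-insert {x = x} {ys = y ∷ ys} (x≢y ∷ x∉ys) (y∉ys ∷ ys!) with T x y
  ... | true  = (x≢y ∷ x∉ys) ∷ y∉ys ∷ ys!
  ... | false = All-insert (x≢y ∘ sym) y∉ys ∷ Unique-insert x∉ys ys!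

  Unique-sort : ∀ {n} {xs : Vec (Fin k) n} → Unique xs → Unique (sort xs)
  Unique-sort []             = []
  Unique-sort (x∉xs ∷ xs!)   = Unique-insert (All-sort x∉xs) (Unique-sort xs!)

  Linked-insert-after : ∀ {n x y} {ys : Vec (Fin k) n} → Arc y x → All (x ≢_) ys →
                        Linked Arc (y ∷ ys) → Linked Arc (y ∷ insert x ys)
  Linked-insert-after {ys = []}     yx _ _ = yx ∷ [-]
  Linked-insert-after {x = x} {ys = z ∷ zs} yx (x≢z ∷ x∉zs) (yz ∷ zs~) with T x z in xz
  ... | true  = yx ∷ xz ∷ zs~
  ... | false = yz ∷ Linked-insert-after (reverse-arc tour x≢z xz) x∉zs zs~

  Linked-insert : ∀ {n x} {ys : Vec (Fin k) n} → All (x ≢_) ys → Linked Arc ys → Linked Arc (insert x ys)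
  Linked-insert {ys = []}     _              _   = [-]
  Linked-insert {x = x} {ys = y ∷ ys} (x≢y ∷ x∉ys) ys~ with T x y in xy
  ... | true  = xy ∷ ys~
  ... | false = Linked-insert-after (reverse-arc tour x≢y xy) x∉ys ys~

  Linked-sort : ∀ {n} {xs : Vec (Fin k) n} → Unique xs → Linked Arc (sort xs)
  Linked-sort []           = []
  Linked-sort (x∉xs ∷ xs!) = Linked-insert (All-sort x∉xs) (Linked-sort xs!)

  hamiltonianPath : Contains T (pathDigraph k)
  hamiltonianPath = lookup P , lookup-injective (Unique-sort vertices!) _ _ ,
                    λ u v uv → Linked-lookup (Linked-sort vertices!) (dec-true⁻¹ (_ ≟ _) uv)
    where
    vertices! : Unique (allFinV k)
    vertices! = tabulate⁺ id
    P : Vec (Fin k) k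
    P = sort (allFinV k)

c4-path : ∀ i → c4 (inject₁ i) (suc i) ≡ true
c4-path 0F = refl
c4-path 1F = refl
c4-path 2F = refl

c4-embedding : ∀ {n} {D : Digraph n} (f : Fin 4 → Fin n) → Injective _≡_ _≡_ f →
               D (f 0F) (f 1F) ≡ true → D (f 1F) (f 2F) ≡ true → D (f 2F) (f 3F) ≡ true →
               D (f 0F) (f 3F) ≡ true → Contains D c4
c4-embedding {D = D} f f-inj a01 a12 a23 a03 = f , f-inj , hom
  where
  hom : ∀ u v → c4 u v ≡ true → D (f u) (f v) ≡ true
  hom 0F 1F _ = a01
  hom 1F 2F _ = a12
  hom 2F 3F _ = a23
  hom 0F 3F _ = a03
  hom 0F 0F ()
  hom 0F 2F ()
  hom 1F 0F ()
  hom 1F 1F ()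
  hom 1F 3F ()
  hom 2F 0F ()
  hom 2F 1F ()
  hom 2F 2F ()
  hom 3F _  ()

module _ {T : Digraph 4} (tour : Tournament T) {p : Fin 4 → Fin 4} (p-inj : Injective _≡_ _≡_ p) where

  private
    flip : ∀ {i j} → i ≢ j → T (p i) (p j) ≡ false → T (p j) (p i) ≡ true
    flip i≢j = reverse-arc tour (i≢j ∘ p-inj)

    via : (σ : Vec (Fin 4) 4) → {σ! : True (allPairs? (λ i j → ¬? (i ≟ᶠ j)) σ)} →
          T (p (lookup σ 0F)) (p (lookup σ 1F)) ≡ true → T (p (lookup σ 1F)) (p (lookup σ 2F)) ≡ true →
          T (p (lookup σ 2F)) (p (lookup σ 3F)) ≡ true → T (p (lookup σ 0F)) (p (lookup σ 3F)) ≡ true →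
          Contains T c4
    via σ {σ!} = c4-embedding {D = T} (p ∘ lookup σ) (lookup-injective (toWitness σ!) _ _ ∘ p-inj)

  -- p₀ → p₁ → p₂ → p₃ is a Hamiltonian path; the orientations of the three remaining pairs decide
  -- which relabelling σ of it is a copy of c4.
  c4-fromPath : T (p 0F) (p 1F) ≡ true → T (p 1F) (p 2F) ≡ true → T (p 2F) (p 3F) ≡ true → Contains T c4
  c4-fromPath ab bc cd with T (p 0F) (p 3F) in ad | T (p 0F) (p 2F) in ac | T (p 1F) (p 3F) in bd
  ... | true  | _     | _     = via (0F ∷ 1F ∷ 2F ∷ 3F ∷ []) ab bc cd ad
  ... | false | true  | true  = via (1F ∷ 3F ∷ 0F ∷ 2F ∷ []) bd (flip (λ ()) ad) ac bc
  ... | false | true  | false = via (0F ∷ 2F ∷ 3F ∷ 1F ∷ []) ac cd (flip (λ ()) bd) ab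
  ... | false | false | true  = via (2F ∷ 0F ∷ 1F ∷ 3F ∷ []) (flip (λ ()) ac) ab bd cd
  ... | false | false | false = via (3F ∷ 1F ∷ 2F ∷ 0F ∷ []) (flip (λ ()) bd) bc (flip (λ ()) ac) (flip (λ ()) ad)

c4-in-tournament : ∀ {T : Digraph 4} → Tournament T → Contains T c4
c4-in-tournament tour =
  let _ , p-inj , p-hom = Rédei.hamiltonianPath tour
  in c4-fromPath tour p-inj (p-hom 0F 1F refl) (p-hom 1F 2F refl) (p-hom 2F 3F refl)

-- Compressibility

hom? : ∀ {m k} (F : Digraph m) (T : Digraph k) → Dec (Hom F T)
hom? {m} {k} F T = map′ (λ (c , c-hom) → finToFun c , c-hom)
                        (λ (f , f-hom) → funToFin f , isHom-funToFin f f-hom)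
                        (any? (isHom? ∘ finToFun))
  where
  IsHom : (Fin m → Fin k) → Set
  IsHom f = ∀ u v → F u v ≡ true → T (f u) (f v) ≡ true
  isHom? : ∀ f → Dec (IsHom f)
  isHom? f = all? λ u → all? λ v → (F u v ≟ᵇ true) →-dec (T (f u) (f v) ≟ᵇ true)
  isHom-funToFin : ∀ f → IsHom f → IsHom (finToFun (funToFin f))
  isHom-funToFin f f-hom u v uv = subst₂ (λ x y → T x y ≡ true)
    (sym (finToFun-funToFin f u)) (sym (finToFun-funToFin f v)) (f-hom u v uv)

tournament? : ∀ {k} (T : Digraph k) → Dec (Tournament T)
tournament? T =
  (  (all? λ u → T u u ≟ᵇ false)
  ×-dec (all? λ u → all? λ v → (T u v ≟ᵇ true) →-dec (T v u ≟ᵇ false)))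
  ×-dec (all? λ u → all? λ v → ¬? (u ≟ᶠ v) →-dec ((T u v ≟ᵇ true) ⊎-dec (T v u ≟ᵇ true)))

-- A digraph on Fin k is coded by a number below (2 ^ k) ^ k: one base-2 ^ k digit per row,
-- the row being read off in base 2.
decode : ∀ {k} → Fin ((2 ^ k) ^ k) → Digraph k
decode c a b = Inverse.to 2↔Bool (finToFun (finToFun c a) b)

encode : ∀ {k} → Digraph k → Fin ((2 ^ k) ^ k)
encode T = funToFin λ a → funToFin λ b → Inverse.from 2↔Bool (T a b)

decode-encode : ∀ {k} (T : Digraph k) a b → decode (encode T) a b ≡ T a b
decode-encode T a b = begin
  Inverse.to 2↔Bool (finToFun (finToFun (encode T) a) b)
    ≡⟨ cong (λ row → Inverse.to 2↔Bool (finToFun row b)) (finToFun-funToFin _ a) ⟩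
  Inverse.to 2↔Bool (finToFun (funToFin λ b → Inverse.from 2↔Bool (T a b)) b)
    ≡⟨ cong (Inverse.to 2↔Bool) (finToFun-funToFin _ b) ⟩
  Inverse.to 2↔Bool (Inverse.from 2↔Bool (T a b))
    ≡⟨ Inverse.strictlyInverseˡ 2↔Bool (T a b) ⟩
  T a b ∎
  where open ≡-Reasoning

tournamentWithoutHom : ∀ {m} (F : Digraph m) k → ¬ HomToAllTournaments F k →
                       Σ (Digraph k) λ T → Tournament T × ¬ Hom F T
tournamentWithoutHom F k ¬F→all with any? (λ c → tournament? (decode c) ×-dec ¬? (hom? F (decode c)))
... | yes (c , tour , F↛T) = decode c , tour , F↛T
... | no  none = ⊥-elim (¬F→all F→T)
  where
  F→T : HomToAllTournaments F k
  F→T T tour with hom? F T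
  ... | yes F→T′ = F→T′
  ... | no  F↛T  = ⊥-elim (none (encode T , Tournament-≗ (λ a b → sym (decode-encode T a b)) tour
                                           , F↛T ∘ Hom-≗ (decode-encode T)))

compressibility-≥ : ∀ {m} {F : Digraph m} → Tournament F → ∀ {z} → IsCompressibility F z → m ≤ z
compressibility-≥ F-tour (F→all , _) =
  let _ , f-inj , _ = tournament-Hom⇒Contains F-tour (proj₁ transitive-tournament) (F→all _ transitive-tournament)
  in injective⇒≤ f-inj

exOri-tournament : ∀ {m} {F : Digraph m} → Tournament F → ∀ r → IsCompressibility F (suc (suc r)) →
                   ∀ n → ExOri n F (turanEdges n (suc r))
exOri-tournament {F = F} F-tour r (F→all , minimal) =
  let _ , T₀-tour , F↛T₀ = tournamentWithoutHom F (suc r) λ F→all′ → n≮n (suc r) (minimal (suc r) F→all′)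
  in exOri≡turanEdges F r (λ T tour → tournament-Hom⇒Contains F-tour (proj₁ tour) (F→all T tour)) T₀-tour F↛T₀

corollary2p2 :
    ((k n : ℕ) → 2 ≤ k → ExOri n (pathDigraph k) (turanEdges n (k ∸ 1)))
    × ((m : ℕ) → 2 ≤ m → (F : Digraph m) → Tournament F → (z : ℕ) →
        IsCompressibility F z → (n : ℕ) → ExOri n F (turanEdges n (z ∸ 1)))
    × ((n : ℕ) → ExOri n c4 (turanEdges n 3))
corollary2p2 = paths , tournaments , orientedC4
  where
  paths : (k n : ℕ) → 2 ≤ k → ExOri n (pathDigraph k) (turanEdges n (k ∸ 1))
  paths 1             _ (s≤s ())
  paths (suc (suc r)) n _ =
    exOri≡turanEdges (pathDigraph _) r (λ _ → Rédei.hamiltonianPath) transitive-tournament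
                     (¬Hom-transitive _ pathDigraph-arc) n

  tournaments : (m : ℕ) → 2 ≤ m → (F : Digraph m) → Tournament F → (z : ℕ) →
                IsCompressibility F z → (n : ℕ) → ExOri n F (turanEdges n (z ∸ 1))
  tournaments m 2≤m F F-tour z comp = by-size z (≤-trans 2≤m (compressibility-≥ F-tour comp)) comp
    where
    by-size : ∀ z → 2 ≤ z → IsCompressibility F z → (n : ℕ) → ExOri n F (turanEdges n (z ∸ 1))
    by-size 1             (s≤s ())
    by-size (suc (suc r)) _ = exOri-tournament F-tour r

  orientedC4 : (n : ℕ) → ExOri n c4 (turanEdges n 3)
  orientedC4 = exOri≡turanEdges c4 2 (λ _ → c4-in-tournament) transitive-tournament (¬Hom-transitive c4 c4-path)
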